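{- If a functorial interpretation $\phi$ of a polygraphic program $\Pi$ is cartesian, then $\phi$ is compatible with and conservative on every structure $3$-cell of $\Pi$.
   Context: A polygraphic program is a finite 3-polygraph with a single $0$-cell $\ast$; $k$-paths compose by $\star_j$ ($0\le j<k$). Its $2$-cells split into structure $2$-cells $\tau_{\xi,\zeta}:\xi\star_0\zeta\Rightarrow\zeta\star_0\xi$, $\delta_\xi:\xi\Rightarrow\xi\star_0\xi$, $\epsilon_\xi:\xi\Rightarrow\ast$ ($\xi,\zeta$ $1$-cells), constructor $2$-cells (target a single $1$-cell) and function $2$-cells. Structure $2$-paths are defined inductively: $\tau_{\ast,\zeta}$, $\tau_{\zeta,\ast}$, $\delta_\ast$, $\epsilon_\ast$ are identities, $\tau_{\xi\star_0u,\zeta}=(\xi\star_0\tau_{u,\zeta})\star_1(\tau_{\xi,\zeta}\star_0u)$, $\tau_{\zeta,\xi\star_0u}=(\tau_{\zeta,\xi}\star_0u)\star_1(\xi\star_0\tau_{\zeta,u})$, $\delta_{\xi\star_0u}=(\delta_\xi\star_0\delta_u)\star_1(\xi\star_0\tau_{\xi,u}\star_0u)$, $\epsilon_{\xi\star_0u}=\epsilon_\xi\star_0\epsilon_u$. The structure $3$-cells are, for each constructor $c:u\Rightarrow\xi$ and each $1$-cell $\zeta$: $(c\star_0\zeta)\star_1\tau_{\xi,\zeta}\Rrightarrow\tau_{u,\zeta}\star_1(\zeta\star_0c)$, $(\zeta\star_0c)\star_1\tau_{\zeta,\xi}\Rrightarrow\tau_{\zeta,u}\star_1(c\star_0\zeta)$,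 $c\star_1\delta_\xi\Rrightarrow\delta_u\star_1(c\star_0c)$, $c\star_1\epsilon_\xi\Rrightarrow\epsilon_u$. A functorial interpretation $\phi$ assigns to each $1$-path $u$ with $n$ $1$-cells a nonempty $\phi(u)\subseteq(\mathbb{N}\setminus\{0\})^n$ ($\phi(\ast)$ a singleton) and to each $2$-path $f:u\Rightarrow v$ a monotone map $\phi(f):\phi(u)\to\phi(v)$ (product order), with $\phi(u\star_0v)=\phi(u)\times\phi(v)$, $\phi(f\star_0g)=\phi(f)\times\phi(g)$, $\phi(f\star_1g)=\phi(g)\circ\phi(f)$, identities to identities. It is cartesian if $\phi(\delta_\xi)(x)=(x,x)$ and $\phi(\tau_{\xi,\zeta})(x,y)=(y,x)$ for all $1$-cells. It is compatible with a $3$-cell $\alpha$ if $\phi(s_2\alpha)\ge\phi(t_2\alpha)$ pointwise. $\partial_\phi$ assigns to each $2$-path a map into $\mathbb{N}$ determined by $\partial_\phi(\text{identity})=0$, $\partial_\phi(f\star_0g)(x,y)=\max\{\partial_\phi f(x),\partial_\phi g(y)\}$, $\partial_\phi(f\star_1g)=\max\{\partial_\phi f,\partial_\phi g\circ\phi(f)\}$, and $\partial_\phi c(x_1,\dots,x_m)=\max\{x_1,\dots,x_m,y_1,\dots,y_n\}$ with $(y_i)=\phi(c)(x)$ for $2$-cells $c$; $\phi$ is conservative on $\alpha$ if $\partial_\phi(s_2\alpha)\ge\partial_\phi(t_2\alpha)$ pointwise. -}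

module Defs where

open import Data.Nat using (ℕ; zero; suc; _≤_; _⊔_)
open import Data.Fin using (Fin)
open import Data.List using (List; []; _∷_; _++_; [_])
open import Data.List.Properties using (++-assoc)
open import Data.Product using (Σ; _×_; _,_; proj₁; proj₂)
open import Data.Unit using (⊤; tt)
open import Relation.Binary.PropositionalEquality using (_≡_; cong; subst)

-- Single 0-cell *, finitely many 1-cells (Fin n₁).  1-paths are lists of
-- 1-cells (the empty list is the identity 1-path of *, ⋆₀ is _++_).
-- 2-cells: the structure 2-cells τ_{ξ,ζ}, δ_ξ, ε_ξ for all 1-cells ξ ζ,
-- the constructor 2-cells (target a single 1-cell) and the function
-- 2-cells.

record Signature : Set where
  field
    n₁     : ℕ
    nCon   : ℕ
    conSrc : Fin nCon → List (Fin n₁)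
    conTgt : Fin nCon → Fin n₁
    nFun   : ℕ
    funSrc : Fin nFun → List (Fin n₁)
    funTgt : Fin nFun → List (Fin n₁)

module _ (S : Signature) where
  open Signature S

  Cell1 : Set
  Cell1 = Fin n₁

  Path1 : Set
  Path1 = List Cell1

  data Cell2 : Set where
    τ   : Cell1 → Cell1 → Cell2
    δ   : Cell1 → Cell2
    ε   : Cell1 → Cell2
    con : Fin nCon → Cell2
    fun : Fin nFun → Cell2

  src₂ : Cell2 → Path1
  src₂ (τ ξ ζ) = ξ ∷ ζ ∷ []
  src₂ (δ ξ)   = ξ ∷ []
  src₂ (ε ξ)   = ξ ∷ []
  src₂ (con c) = conSrc c
  src₂ (fun f) = funSrc f

  tgt₂ : Cell2 → Path1
  tgt₂ (τ ξ ζ) = ζ ∷ ξ ∷ []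
  tgt₂ (δ ξ)   = ξ ∷ ξ ∷ []
  tgt₂ (ε ξ)   = []
  tgt₂ (con c) = conTgt c ∷ []
  tgt₂ (fun f) = funTgt f

  -- 2-paths of the free 2-category (terms; ⋆₀ on 1-paths is _++_).
  -- 'cast' transports along an equality of 1-paths (strict associativity).
  data Path2 : Path1 → Path1 → Set where
    gen  : (c : Cell2) → Path2 (src₂ c) (tgt₂ c)
    idp  : (u : Path1) → Path2 u u
    _⋆₀_ : ∀ {u v u' v'} → Path2 u v → Path2 u' v' → Path2 (u ++ u') (v ++ v')
    _⋆₁_ : ∀ {u v w} → Path2 u v → Path2 v w → Path2 u w
    cast : ∀ {u v v'} → v ≡ v' → Path2 u v → Path2 u v'

  τL : (u : Path1) (ζ : Cell1) → Path2 (u ++ [ ζ ]) (ζ ∷ u)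
  τL []      ζ = idp [ ζ ]
  τL (ξ ∷ u) ζ = (idp [ ξ ] ⋆₀ τL u ζ) ⋆₁ (gen (τ ξ ζ) ⋆₀ idp u)

  τR : (ζ : Cell1) (u : Path1) → Path2 (ζ ∷ u) (u ++ [ ζ ])
  τR ζ []      = idp [ ζ ]
  τR ζ (ξ ∷ u) = (gen (τ ζ ξ) ⋆₀ idp u) ⋆₁ (idp [ ξ ] ⋆₀ τR ζ u)

  δP : (u : Path1) → Path2 u (u ++ u)
  δP []      = idp []
  δP (ξ ∷ u) =
    (gen (δ ξ) ⋆₀ δP u) ⋆₁
    cast (cong (ξ ∷_) (++-assoc u [ ξ ] u))
         (idp [ ξ ] ⋆₀ (τR ξ u ⋆₀ idp u))

  εP : (u : Path1) → Path2 u []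
  εP []      = idp []
  εP (ξ ∷ u) = gen (ε ξ) ⋆₀ εP u

  record Cell3Shape : Set where
    field
      s₁ t₁ : Path1
      s₂ t₂ : Path2 s₁ t₁

  data Struct3 : Set where
    τ-left  : Fin nCon → Cell1 → Struct3
    τ-right : Fin nCon → Cell1 → Struct3
    δ-cell  : Fin nCon → Struct3
    ε-cell  : Fin nCon → Struct3

  struct3 : Struct3 → Cell3Shape
  struct3 (τ-left c ζ) = record
    { s₁ = conSrc c ++ [ ζ ] ; t₁ = ζ ∷ conTgt c ∷ []
    ; s₂ = (gen (con c) ⋆₀ idp [ ζ ]) ⋆₁ gen (τ (conTgt c) ζ)
    ; t₂ = τL (conSrc c) ζ ⋆₁ (idp [ ζ ] ⋆₀ gen (con c)) }
  struct3 (τ-right c ζ) = record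
    { s₁ = ζ ∷ conSrc c ; t₁ = conTgt c ∷ ζ ∷ []
    ; s₂ = (idp [ ζ ] ⋆₀ gen (con c)) ⋆₁ gen (τ ζ (conTgt c))
    ; t₂ = τR ζ (conSrc c) ⋆₁ (gen (con c) ⋆₀ idp [ ζ ]) }
  struct3 (δ-cell c) = record
    { s₁ = conSrc c ; t₁ = conTgt c ∷ conTgt c ∷ []
    ; s₂ = gen (con c) ⋆₁ gen (δ (conTgt c))
    ; t₂ = δP (conSrc c) ⋆₁ (gen (con c) ⋆₀ gen (con c)) }
  struct3 (ε-cell c) = record
    { s₁ = conSrc c ; t₁ = []
    ; s₂ = gen (con c) ⋆₁ gen (ε (conTgt c))
    ; t₂ = εP (conSrc c) }

-- Polygraphic program: signature + 3-cells, which are the structure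
-- 3-cells together with the remaining (function-defining) 3-cells.

record Program : Set where
  field
    sig    : Signature
    nRules : ℕ
    rule   : Fin nRules → Cell3Shape sig

module _ (Π : Program) where
  open Program Π

  data Cell3 : Set where
    struct : Struct3 sig → Cell3
    rl     : Fin nRules → Cell3

  shape₃ : Cell3 → Cell3Shape sig
  shape₃ (struct a) = struct3 sig a
  shape₃ (rl r)     = rule r

module _ {A : Set} where
  Val : List A → Set
  Val []      = ⊤
  Val (_ ∷ u) = ℕ × Val u

  _≤V_ : {u : List A} → Val u → Val u → Set
  _≤V_ {[]}    _        _        = ⊤
  _≤V_ {_ ∷ u} (x , xs) (y , ys) = x ≤ y × xs ≤V ys

  splitV : (u : List A) {v : List A} → Val (u ++ v) → Val u × Val v
  splitV []      xs       = tt , xs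
  splitV (_ ∷ u) (x , xs) = let (p , q) = splitV u xs in (x , p) , q

  joinV : {u v : List A} → Val u → Val v → Val (u ++ v)
  joinV {[]}    _        ys = ys
  joinV {_ ∷ u} (x , xs) ys = x , joinV xs ys

  InP : (A → ℕ → Set) → (u : List A) → Val u → Set
  InP P []      _        = ⊤
  InP P (ξ ∷ u) (x , xs) = P ξ x × InP P u xs

  maxV : {u : List A} → Val u → ℕ
  maxV {[]}    _        = 0
  maxV {_ ∷ u} (x , xs) = x ⊔ maxV xs

-- Functorial interpretations.  φ on 1-paths is forced to be the product
-- of φ on 1-cells (φ(u ⋆₀ v) = φ(u) × φ(v), φ(*) the singleton), and φ on
-- 2-paths is forced by functoriality from φ on 2-cells.  Subsets of ℕ
-- are predicates; a map φ(u) → φ(v) is a function on tuples together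
-- with the proof that it sends φ(u) into φ(v) (its values outside φ(u)
-- are never used).

record Interpretation (Π : Program) : Set₁ where
  open Program Π
  field
    φ₁      : Cell1 sig → ℕ → Set
    φ₁-pos  : ∀ ξ x → φ₁ ξ x → 1 ≤ x
    φ₁-ne   : ∀ ξ → Σ ℕ (φ₁ ξ)
    φ₂      : (c : Cell2 sig) → Val (src₂ sig c) → Val (tgt₂ sig c)
    φ₂-into : ∀ c x → InP φ₁ (src₂ sig c) x → InP φ₁ (tgt₂ sig c) (φ₂ c x)
    φ₂-mono : ∀ c x y → InP φ₁ (src₂ sig c) x → InP φ₁ (src₂ sig c) y →
              x ≤V y → φ₂ c x ≤V φ₂ c y

  Inφ : (u : Path1 sig) → Val u → Set
  Inφ = InP φ₁

module _ {Π : Program} (φ : Interpretation Π) where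
  open Program Π
  open Interpretation φ

  ⟦_⟧ : ∀ {u v} → Path2 sig u v → Val u → Val v
  ⟦ gen c ⟧    x = φ₂ c x
  ⟦ idp u ⟧    x = x
  ⟦ _⋆₀_ {u = u} f g ⟧ x = let (a , b) = splitV u x in joinV (⟦ f ⟧ a) (⟦ g ⟧ b)
  ⟦ f ⋆₁ g ⟧   x = ⟦ g ⟧ (⟦ f ⟧ x)
  ⟦ cast e f ⟧ x = subst Val e (⟦ f ⟧ x)

  ∂ : ∀ {u v} → Path2 sig u v → Val u → ℕ
  ∂ (gen c)    x = maxV x ⊔ maxV (φ₂ c x)
  ∂ (idp u)    x = 0
  ∂ (_⋆₀_ {u = u} f g) x = let (a , b) = splitV u x in ∂ f a ⊔ ∂ g b
  ∂ (f ⋆₁ g)   x = ∂ f x ⊔ ∂ g (⟦ f ⟧ x)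
  ∂ (cast e f) x = ∂ f x

  Cartesian : Set
  Cartesian =
    (∀ ξ x → φ₁ ξ x → φ₂ (δ ξ) (x , tt) ≡ (x , x , tt)) ×
    (∀ ξ ζ x y → φ₁ ξ x → φ₁ ζ y → φ₂ (τ ξ ζ) (x , y , tt) ≡ (y , x , tt))

  CompatibleWith : Cell3 Π → Set
  CompatibleWith α = ∀ x → Inφ s₁ x → ⟦ t₂ ⟧ x ≤V ⟦ s₂ ⟧ x
    where open Cell3Shape (shape₃ Π α)

  ConservativeOn : Cell3 Π → Set
  ConservativeOn α = ∀ x → Inφ s₁ x → ∂ t₂ x ≤ ∂ s₂ x
    where open Cell3Shape (shape₃ Π α)

  IsStructure3 : Cell3 Π → Set
  IsStructure3 α = Σ (Struct3 sig) (λ a → struct a ≡ α)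

{-# OPTIONS --safe #-}

-- For a cartesian φ the structure 2-paths τ_{u,ζ}, τ_{ζ,u}, δ_u and ε_u are interpreted as
-- the evident permutation, duplication and erasure of coordinates, so both sides of every
-- structure 3-cell have the same interpretation.  These 2-paths are moreover non-expanding:
-- neither their output nor their ∂ exceeds the largest input coordinate.  On the source side
-- of a structure 3-cell every input coordinate is already recorded in ∂, by the constructor
-- (its own inputs) or by τ (the passive coordinate), which gives conservativity.

module Submission where

open import Defs
open import Data.Product using (_×_; _,_; proj₁; proj₂)
open import Data.Nat using (ℕ; _≤_; _⊔_; z≤n)
open import Data.Nat.Properties
  using (≤-refl; ≤-reflexive; ≤-trans; ⊔-lub; ⊔-mono-≤; ⊔-assoc; ⊔-idem; ⊔-commutativeSemigroup;
         m≤m⊔n; m≤n⊔m; module ≤-Reasoning)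
open import Algebra.Properties.CommutativeSemigroup ⊔-commutativeSemigroup using (x∙yz≈y∙xz)
open import Data.List using (List; []; _∷_; _++_; [_])
open import Data.List.Properties using (++-assoc)
open import Data.Unit using (tt)
open import Relation.Binary.PropositionalEquality
  using (_≡_; refl; sym; trans; cong; cong₂; subst; module ≡-Reasoning)

module _ {A : Set} where

  ≤V-reflexive : {u : List A} {x y : Val u} → x ≡ y → x ≤V y
  ≤V-reflexive {[]}    _    = tt
  ≤V-reflexive {_ ∷ u} refl = ≤-refl , ≤V-reflexive {u} refl

  data Split (u : List A) {v : List A} : Val (u ++ v) → Set where
    join : (a : Val u) (b : Val v) → Split u (joinV a b)

  split : (u : List A) {v : List A} (x : Val (u ++ v)) → Split u x
  split []      x = join tt x
  split (_ ∷ u) (x , xs) with split u xs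
  ... | join a b = join (x , a) b

  splitV-joinV : (u : List A) {v : List A} (a : Val u) (b : Val v) → splitV u (joinV a b) ≡ (a , b)
  splitV-joinV []      _       _ = refl
  splitV-joinV (_ ∷ u) (x , a) b rewrite splitV-joinV u a b = refl

  maxV-joinV : {u v : List A} (a : Val u) (b : Val v) → maxV (joinV a b) ≡ maxV a ⊔ maxV b
  maxV-joinV {[]}    _       _ = refl
  maxV-joinV {_ ∷ u} (x , a) b = trans (cong (x ⊔_) (maxV-joinV a b)) (sym (⊔-assoc x _ _))

  maxV-subst : {u v : List A} (e : u ≡ v) (x : Val u) → maxV (subst Val e x) ≡ maxV x
  maxV-subst refl _ = refl

  subst-∷ : (ξ : A) {u v : List A} (e : u ≡ v) (x : ℕ) (xs : Val u) →
            subst Val (cong (ξ ∷_) e) (x , xs) ≡ (x , subst Val e xs)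
  subst-∷ _ refl _ _ = refl

  joinV-assoc : (u v w : List A) (a : Val u) (b : Val v) (c : Val w) →
                subst Val (++-assoc u v w) (joinV (joinV a b) c) ≡ joinV a (joinV b c)
  joinV-assoc []      v w _       b c = refl
  joinV-assoc (ξ ∷ u) v w (x , a) b c =
    trans (subst-∷ ξ (++-assoc u v w) x _) (cong (x ,_) (joinV-assoc u v w a b c))

  module _ (P : A → ℕ → Set) where

    InP-joinV : {u v : List A} {a : Val u} {b : Val v} → InP P u a → InP P v b → InP P (u ++ v) (joinV a b)
    InP-joinV {[]}    _         hb = hb
    InP-joinV {_ ∷ u} (hx , ha) hb = hx , InP-joinV ha hb

    InP-joinV⁻ : {u v : List A} (a : Val u) (b : Val v) → InP P (u ++ v) (joinV a b) → InP P u a × InP P v b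
    InP-joinV⁻ {[]}    _       _ h        = tt , h
    InP-joinV⁻ {_ ∷ u} (_ , a) b (hx , h) = let (ha , hb) = InP-joinV⁻ a b h in (hx , ha) , hb

    InP-subst : {u v : List A} (e : u ≡ v) {x : Val u} → InP P u x → InP P v (subst Val e x)
    InP-subst refl h = h

module _ {Π : Program} (φ : Interpretation Π) where
  open Program Π
  open Interpretation φ
  open Signature sig using (conSrc; conTgt)

  private variable u v w u′ v′ v″ : Path1 sig

  ⟦⋆₀⟧-joinV : (f : Path2 sig u v) (g : Path2 sig u′ v′) (a : Val u) (b : Val u′) →
               ⟦ φ ⟧ (f ⋆₀ g) (joinV a b) ≡ joinV (⟦ φ ⟧ f a) (⟦ φ ⟧ g b)
  ⟦⋆₀⟧-joinV {u} f g a b = cong (λ (a , b) → joinV (⟦ φ ⟧ f a) (⟦ φ ⟧ g b)) (splitV-joinV u a b)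

  ∂-⋆₀-joinV : (f : Path2 sig u v) (g : Path2 sig u′ v′) (a : Val u) (b : Val u′) →
               ∂ φ (f ⋆₀ g) (joinV a b) ≡ ∂ φ f a ⊔ ∂ φ g b
  ∂-⋆₀-joinV {u} f g a b = cong (λ (a , b) → ∂ φ f a ⊔ ∂ φ g b) (splitV-joinV u a b)

  ⟦⟧-into : (f : Path2 sig u v) (x : Val u) → Inφ u x → Inφ v (⟦ φ ⟧ f x)
  ⟦⟧-into (gen c)    x h = φ₂-into c x h
  ⟦⟧-into (idp u)    x h = h
  ⟦⟧-into (_⋆₀_ {u = u} f g) x h with split u x
  ... | join a b =
    let (ha , hb) = InP-joinV⁻ φ₁ a b h
    in subst (Inφ _) (sym (⟦⋆₀⟧-joinV f g a b)) (InP-joinV φ₁ (⟦⟧-into f a ha) (⟦⟧-into g b hb))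
  ⟦⟧-into (f ⋆₁ g)   x h = ⟦⟧-into g (⟦ φ ⟧ f x) (⟦⟧-into f x h)
  ⟦⟧-into (cast e f) x h = InP-subst φ₁ e (⟦⟧-into f x h)

  record NonExpanding (f : Path2 sig u v) : Set where
    field bounds : ∀ x → Inφ u x → maxV (⟦ φ ⟧ f x) ≤ maxV x × ∂ φ f x ≤ maxV x
  open NonExpanding

  idp-nonExpanding : (u : Path1 sig) → NonExpanding (idp u)
  bounds (idp-nonExpanding u) x _ = ≤-refl , z≤n

  gen-nonExpanding : (c : Cell2 sig) → (∀ x → Inφ (src₂ sig c) x → maxV (φ₂ c x) ≤ maxV x) →
                     NonExpanding (gen c)
  bounds (gen-nonExpanding c bound) x h = bound x h , ⊔-lub ≤-refl (bound x h)

  ⋆₀-nonExpanding : {f : Path2 sig u v} {g : Path2 sig u′ v′} →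
                    NonExpanding f → NonExpanding g → NonExpanding (f ⋆₀ g)
  bounds (⋆₀-nonExpanding {u} {f = f} {g} nf ng) x h with split u x
  ... | join a b =
    let (ha , hb) = InP-joinV⁻ φ₁ a b h
        (fa-max , fa-∂) = bounds nf a ha
        (gb-max , gb-∂) = bounds ng b hb
    in
    (begin
      maxV (⟦ φ ⟧ (f ⋆₀ g) (joinV a b))    ≡⟨ cong maxV (⟦⋆₀⟧-joinV f g a b) ⟩
      maxV (joinV (⟦ φ ⟧ f a) (⟦ φ ⟧ g b)) ≡⟨ maxV-joinV (⟦ φ ⟧ f a) (⟦ φ ⟧ g b) ⟩
      maxV (⟦ φ ⟧ f a) ⊔ maxV (⟦ φ ⟧ g b)  ≤⟨ ⊔-mono-≤ fa-max gb-max ⟩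
      maxV a ⊔ maxV b                       ≡⟨ maxV-joinV a b ⟨
      maxV (joinV a b)                      ∎) ,
    (begin
      ∂ φ (f ⋆₀ g) (joinV a b) ≡⟨ ∂-⋆₀-joinV f g a b ⟩
      ∂ φ f a ⊔ ∂ φ g b        ≤⟨ ⊔-mono-≤ fa-∂ gb-∂ ⟩
      maxV a ⊔ maxV b          ≡⟨ maxV-joinV a b ⟨
      maxV (joinV a b)         ∎)
    where open ≤-Reasoning

  ⋆₁-nonExpanding : {f : Path2 sig u v} {g : Path2 sig v w} →
                    NonExpanding f → NonExpanding g → NonExpanding (f ⋆₁ g)
  bounds (⋆₁-nonExpanding {f = f} nf ng) x h =
    let (fx-max , fx-∂) = bounds nf x h
        (gfx-max , gfx-∂) = bounds ng (⟦ φ ⟧ f x) (⟦⟧-into f x h)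
    in ≤-trans gfx-max fx-max , ⊔-lub fx-∂ (≤-trans gfx-∂ fx-max)

  cast-nonExpanding : (e : v ≡ v″) {f : Path2 sig u v} →
                      NonExpanding f → NonExpanding (cast e f)
  bounds (cast-nonExpanding e {f} nf) x h =
    let (fx-max , fx-∂) = bounds nf x h
    in ≤-trans (≤-reflexive (maxV-subst e (⟦ φ ⟧ f x))) fx-max , fx-∂

  maxV≤∂-gen : (c : Cell2 sig) (x : Val (src₂ sig c)) → maxV x ≤ ∂ φ (gen c) x
  maxV≤∂-gen c x = m≤m⊔n (maxV x) (maxV (φ₂ c x))

  ∂-⋆₁-≤ : {f : Path2 sig u v} (g : Path2 sig v w) {m : ℕ} → NonExpanding f →
           ∀ x → Inφ u x → maxV x ≤ m → ∂ φ g (⟦ φ ⟧ f x) ≤ m → ∂ φ (f ⋆₁ g) x ≤ m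
  ∂-⋆₁-≤ g nf x h x≤m g≤m = ⊔-lub (≤-trans (proj₂ (bounds nf x h)) x≤m) g≤m

  module _ (cartesian : Cartesian φ) where

    δ-diagonal : ∀ ξ x → φ₁ ξ x → φ₂ (δ ξ) (x , tt) ≡ (x , x , tt)
    δ-diagonal = proj₁ cartesian

    τ-swap : ∀ ξ ζ x y → φ₁ ξ x → φ₁ ζ y → φ₂ (τ ξ ζ) (x , y , tt) ≡ (y , x , tt)
    τ-swap = proj₂ cartesian

    τ-nonExpanding : ∀ ξ ζ → NonExpanding (gen (τ ξ ζ))
    τ-nonExpanding ξ ζ = gen-nonExpanding (τ ξ ζ) λ (x , y , tt) (hx , hy , tt) →
      ≤-reflexive (trans (cong (maxV {u = ζ ∷ ξ ∷ []}) (τ-swap ξ ζ x y hx hy)) (x∙yz≈y∙xz y x 0))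

    δ-nonExpanding : ∀ ξ → NonExpanding (gen (δ ξ))
    δ-nonExpanding ξ = gen-nonExpanding (δ ξ) λ (x , tt) (hx , tt) →
      ≤-reflexive (begin
        maxV {u = ξ ∷ ξ ∷ []} (φ₂ (δ ξ) (x , tt)) ≡⟨ cong (maxV {u = ξ ∷ ξ ∷ []}) (δ-diagonal ξ x hx) ⟩
        x ⊔ (x ⊔ 0)                              ≡⟨ ⊔-assoc x x 0 ⟨
        (x ⊔ x) ⊔ 0                              ≡⟨ cong (_⊔ 0) (⊔-idem x) ⟩
        x ⊔ 0                                    ∎)
      where open ≡-Reasoning

    ε-nonExpanding : ∀ ξ → NonExpanding (gen (ε ξ))
    ε-nonExpanding ξ = gen-nonExpanding (ε ξ) λ _ _ → z≤n

    τL-nonExpanding : ∀ u ζ → NonExpanding (τL sig u ζ)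
    τL-nonExpanding []      ζ = idp-nonExpanding [ ζ ]
    τL-nonExpanding (ξ ∷ u) ζ =
      ⋆₁-nonExpanding (⋆₀-nonExpanding (idp-nonExpanding [ ξ ]) (τL-nonExpanding u ζ))
                      (⋆₀-nonExpanding (τ-nonExpanding ξ ζ) (idp-nonExpanding u))

    τR-nonExpanding : ∀ ζ u → NonExpanding (τR sig ζ u)
    τR-nonExpanding ζ []      = idp-nonExpanding [ ζ ]
    τR-nonExpanding ζ (ξ ∷ u) =
      ⋆₁-nonExpanding (⋆₀-nonExpanding (τ-nonExpanding ζ ξ) (idp-nonExpanding u))
                      (⋆₀-nonExpanding (idp-nonExpanding [ ξ ]) (τR-nonExpanding ζ u))

    δP-nonExpanding : ∀ u → NonExpanding (δP sig u)
    δP-nonExpanding []      = idp-nonExpanding []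
    δP-nonExpanding (ξ ∷ u) =
      ⋆₁-nonExpanding (⋆₀-nonExpanding (δ-nonExpanding ξ) (δP-nonExpanding u))
        (cast-nonExpanding (cong (ξ ∷_) (++-assoc u [ ξ ] u))
          (⋆₀-nonExpanding (idp-nonExpanding [ ξ ])
            (⋆₀-nonExpanding (τR-nonExpanding ξ u) (idp-nonExpanding u))))

    εP-nonExpanding : ∀ u → NonExpanding (εP sig u)
    εP-nonExpanding []      = idp-nonExpanding []
    εP-nonExpanding (ξ ∷ u) = ⋆₀-nonExpanding (ε-nonExpanding ξ) (εP-nonExpanding u)

    ⟦τL⟧ : ∀ u ζ (a : Val u) y → Inφ u a → φ₁ ζ y → ⟦ φ ⟧ (τL sig u ζ) (joinV a (y , tt)) ≡ (y , a)
    ⟦τL⟧ []      ζ _       _ _         _  = refl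
    ⟦τL⟧ (ξ ∷ u) ζ (x , a) y (hx , ha) hy = begin
      ⟦ φ ⟧ (gen (τ ξ ζ) ⋆₀ idp u) (x , ⟦ φ ⟧ (τL sig u ζ) (joinV a (y , tt)))
        ≡⟨ cong (λ t → ⟦ φ ⟧ (gen (τ ξ ζ) ⋆₀ idp u) (x , t)) (⟦τL⟧ u ζ a y ha hy) ⟩
      joinV {u = ζ ∷ ξ ∷ []} (φ₂ (τ ξ ζ) (x , y , tt)) a
        ≡⟨ cong (λ t → joinV {u = ζ ∷ ξ ∷ []} t a) (τ-swap ξ ζ x y hx hy) ⟩
      (y , x , a) ∎
      where open ≡-Reasoning

    ⟦τR⟧ : ∀ ζ u y (a : Val u) → φ₁ ζ y → Inφ u a → ⟦ φ ⟧ (τR sig ζ u) (y , a) ≡ joinV a (y , tt)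
    ⟦τR⟧ ζ []      _ _       _  _         = refl
    ⟦τR⟧ ζ (ξ ∷ u) y (x , a) hy (hx , ha) = begin
      ⟦ φ ⟧ (idp [ ξ ] ⋆₀ τR sig ζ u) (joinV {u = ξ ∷ ζ ∷ []} (φ₂ (τ ζ ξ) (y , x , tt)) a)
        ≡⟨ cong (λ t → ⟦ φ ⟧ (idp [ ξ ] ⋆₀ τR sig ζ u) (joinV {u = ξ ∷ ζ ∷ []} t a)) (τ-swap ζ ξ y x hy hx) ⟩
      (x , ⟦ φ ⟧ (τR sig ζ u) (y , a))
        ≡⟨ cong (x ,_) (⟦τR⟧ ζ u y a hy ha) ⟩
      (x , joinV a (y , tt)) ∎
      where open ≡-Reasoning

    ⟦δP⟧ : ∀ u (a : Val u) → Inφ u a → ⟦ φ ⟧ (δP sig u) a ≡ joinV a a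
    ⟦δP⟧ []      _       _         = refl
    ⟦δP⟧ (ξ ∷ u) (x , a) (hx , ha) = begin
      ⟦ φ ⟧ (cast e (idp [ ξ ] ⋆₀ h)) (joinV {u = ξ ∷ ξ ∷ []} (φ₂ (δ ξ) (x , tt)) (⟦ φ ⟧ (δP sig u) a))
        ≡⟨ cong (λ t → ⟦ φ ⟧ (cast e (idp [ ξ ] ⋆₀ h)) (joinV {u = ξ ∷ ξ ∷ []} t (⟦ φ ⟧ (δP sig u) a)))
                (δ-diagonal ξ x hx) ⟩
      ⟦ φ ⟧ (cast e (idp [ ξ ] ⋆₀ h)) (x , x , ⟦ φ ⟧ (δP sig u) a)
        ≡⟨ cong (λ t → ⟦ φ ⟧ (cast e (idp [ ξ ] ⋆₀ h)) (x , x , t)) (⟦δP⟧ u a ha) ⟩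
      subst Val e (x , ⟦ φ ⟧ h (joinV {u = ξ ∷ u} (x , a) a))
        ≡⟨ cong (λ t → subst Val e (x , t)) (⟦⋆₀⟧-joinV (τR sig ξ u) (idp u) (x , a) a) ⟩
      subst Val e (x , joinV (⟦ φ ⟧ (τR sig ξ u) (x , a)) a)
        ≡⟨ cong (λ t → subst Val e (x , joinV t a)) (⟦τR⟧ ξ u x a hx ha) ⟩
      subst Val e (x , joinV (joinV a (x , tt)) a)
        ≡⟨ joinV-assoc (ξ ∷ u) [ ξ ] u (x , a) (x , tt) a ⟩
      joinV {u = ξ ∷ u} (x , a) (x , a) ∎
      where
      open ≡-Reasoning
      e = cong (ξ ∷_) (++-assoc u [ ξ ] u)
      h = τR sig ξ u ⋆₀ idp u

    τ-left-compatible : ∀ c ζ → CompatibleWith φ (struct (τ-left c ζ))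
    τ-left-compatible c ζ x h with split (conSrc c) x
    ... | join a (y , tt) = ≤V-reflexive {u = ζ ∷ conTgt c ∷ []} (begin
      ⟦ φ ⟧ (idp [ ζ ] ⋆₀ gen (con c)) (⟦ φ ⟧ (τL sig (conSrc c) ζ) (joinV a (y , tt)))
        ≡⟨ cong (⟦ φ ⟧ (idp [ ζ ] ⋆₀ gen (con c))) (⟦τL⟧ (conSrc c) ζ a y ha hy) ⟩
      (y , φ₂ (con c) a)
        ≡⟨ τ-swap (conTgt c) ζ p y hp hy ⟨
      φ₂ (τ (conTgt c) ζ) (p , y , tt)
        ≡⟨ cong (φ₂ (τ (conTgt c) ζ)) (⟦⋆₀⟧-joinV (gen (con c)) (idp [ ζ ]) a (y , tt)) ⟨
      ⟦ φ ⟧ ((gen (con c) ⋆₀ idp [ ζ ]) ⋆₁ gen (τ (conTgt c) ζ)) (joinV a (y , tt)) ∎)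
      where
      open ≡-Reasoning
      ha = proj₁ (InP-joinV⁻ φ₁ a (y , tt) h)
      hy = proj₁ (proj₂ (InP-joinV⁻ φ₁ a (y , tt) h))
      p = proj₁ (φ₂ (con c) a)
      hp = proj₁ (φ₂-into (con c) a ha)

    τ-left-conservative : ∀ c ζ → ConservativeOn φ (struct (τ-left c ζ))
    τ-left-conservative c ζ x h with split (conSrc c) x
    ... | join a (y , tt) = ≤-trans
      (∂-⋆₁-≤ (idp [ ζ ] ⋆₀ gen (con c)) (τL-nonExpanding (conSrc c) ζ) _ h
        (≤-trans (≤-reflexive (maxV-joinV a (y , tt)))
                 (⊔-lub (≤-trans (maxV≤∂-gen (con c) a) con≤M) (⊔-lub y≤M z≤n)))
        (≤-trans (≤-reflexive (cong (∂ φ (idp [ ζ ] ⋆₀ gen (con c))) (⟦τL⟧ (conSrc c) ζ a y ha hy)))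
                 con≤M))
      (≤-reflexive (sym ∂s₂≡M))
      where
      open ≤-Reasoning
      ha = proj₁ (InP-joinV⁻ φ₁ a (y , tt) h)
      hy = proj₁ (proj₂ (InP-joinV⁻ φ₁ a (y , tt) h))
      p = proj₁ (φ₂ (con c) a)
      M = (∂ φ (gen (con c)) a ⊔ 0) ⊔ ∂ φ (gen (τ (conTgt c) ζ)) (p , y , tt)
      ∂s₂≡M : ∂ φ ((gen (con c) ⋆₀ idp [ ζ ]) ⋆₁ gen (τ (conTgt c) ζ)) (joinV a (y , tt)) ≡ M
      ∂s₂≡M = cong₂ _⊔_ (∂-⋆₀-joinV (gen (con c)) (idp [ ζ ]) a (y , tt))
        (cong (∂ φ (gen (τ (conTgt c) ζ))) (⟦⋆₀⟧-joinV (gen (con c)) (idp [ ζ ]) a (y , tt)))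
      con≤M : ∂ φ (gen (con c)) a ≤ M
      con≤M = ≤-trans (m≤m⊔n (∂ φ (gen (con c)) a) 0) (m≤m⊔n (∂ φ (gen (con c)) a ⊔ 0) _)
      y≤M : y ≤ M
      y≤M = begin
        y                                          ≤⟨ ≤-trans (m≤m⊔n y 0) (m≤n⊔m p (y ⊔ 0)) ⟩
        maxV {u = conTgt c ∷ ζ ∷ []} (p , y , tt) ≤⟨ maxV≤∂-gen (τ (conTgt c) ζ) (p , y , tt) ⟩
        ∂ φ (gen (τ (conTgt c) ζ)) (p , y , tt)    ≤⟨ m≤n⊔m (∂ φ (gen (con c)) a ⊔ 0) _ ⟩
        M                                          ∎

    τ-right-compatible : ∀ c ζ → CompatibleWith φ (struct (τ-right c ζ))
    τ-right-compatible c ζ (y , a) (hy , ha) = ≤V-reflexive {u = conTgt c ∷ ζ ∷ []} (begin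
      ⟦ φ ⟧ (gen (con c) ⋆₀ idp [ ζ ]) (⟦ φ ⟧ (τR sig ζ (conSrc c)) (y , a))
        ≡⟨ cong (⟦ φ ⟧ (gen (con c) ⋆₀ idp [ ζ ])) (⟦τR⟧ ζ (conSrc c) y a hy ha) ⟩
      ⟦ φ ⟧ (gen (con c) ⋆₀ idp [ ζ ]) (joinV a (y , tt))
        ≡⟨ ⟦⋆₀⟧-joinV (gen (con c)) (idp [ ζ ]) a (y , tt) ⟩
      (p , y , tt)
        ≡⟨ τ-swap ζ (conTgt c) y p hy hp ⟨
      φ₂ (τ ζ (conTgt c)) (y , p , tt) ∎)
      where
      open ≡-Reasoning
      p = proj₁ (φ₂ (con c) a)
      hp = proj₁ (φ₂-into (con c) a ha)

    τ-right-conservative : ∀ c ζ → ConservativeOn φ (struct (τ-right c ζ))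
    τ-right-conservative c ζ (y , a) (hy , ha) =
      ∂-⋆₁-≤ (gen (con c) ⋆₀ idp [ ζ ]) (τR-nonExpanding ζ (conSrc c)) (y , a) (hy , ha)
        (⊔-lub y≤M (≤-trans (maxV≤∂-gen (con c) a) con≤M)) (begin
          ∂ φ (gen (con c) ⋆₀ idp [ ζ ]) (⟦ φ ⟧ (τR sig ζ (conSrc c)) (y , a))
            ≡⟨ cong (∂ φ (gen (con c) ⋆₀ idp [ ζ ])) (⟦τR⟧ ζ (conSrc c) y a hy ha) ⟩
          ∂ φ (gen (con c) ⋆₀ idp [ ζ ]) (joinV a (y , tt))
            ≡⟨ ∂-⋆₀-joinV (gen (con c)) (idp [ ζ ]) a (y , tt) ⟩
          ∂ φ (gen (con c)) a ⊔ 0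
            ≤⟨ ⊔-lub con≤M z≤n ⟩
          M ∎)
      where
      open ≤-Reasoning
      p = proj₁ (φ₂ (con c) a)
      M = ∂ φ (gen (con c)) a ⊔ ∂ φ (gen (τ ζ (conTgt c))) (y , p , tt)
      con≤M : ∂ φ (gen (con c)) a ≤ M
      con≤M = m≤m⊔n (∂ φ (gen (con c)) a) _
      y≤M : y ≤ M
      y≤M = begin
        y                                          ≤⟨ m≤m⊔n y (p ⊔ 0) ⟩
        maxV {u = ζ ∷ conTgt c ∷ []} (y , p , tt) ≤⟨ maxV≤∂-gen (τ ζ (conTgt c)) (y , p , tt) ⟩
        ∂ φ (gen (τ ζ (conTgt c))) (y , p , tt)    ≤⟨ m≤n⊔m (∂ φ (gen (con c)) a) _ ⟩
        M                                          ∎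

    δ-compatible : ∀ c → CompatibleWith φ (struct (δ-cell c))
    δ-compatible c x h = ≤V-reflexive {u = conTgt c ∷ conTgt c ∷ []} (begin
      ⟦ φ ⟧ (gen (con c) ⋆₀ gen (con c)) (⟦ φ ⟧ (δP sig (conSrc c)) x)
        ≡⟨ cong (⟦ φ ⟧ (gen (con c) ⋆₀ gen (con c))) (⟦δP⟧ (conSrc c) x h) ⟩
      ⟦ φ ⟧ (gen (con c) ⋆₀ gen (con c)) (joinV x x)
        ≡⟨ ⟦⋆₀⟧-joinV (gen (con c)) (gen (con c)) x x ⟩
      (p , p , tt)
        ≡⟨ δ-diagonal (conTgt c) p (proj₁ (φ₂-into (con c) x h)) ⟨
      φ₂ (δ (conTgt c)) (p , tt) ∎)
      where
      open ≡-Reasoning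
      p = proj₁ (φ₂ (con c) x)

    δ-conservative : ∀ c → ConservativeOn φ (struct (δ-cell c))
    δ-conservative c x h =
      ∂-⋆₁-≤ (gen (con c) ⋆₀ gen (con c)) (δP-nonExpanding (conSrc c)) x h
        (≤-trans (maxV≤∂-gen (con c) x) con≤M) (begin
          ∂ φ (gen (con c) ⋆₀ gen (con c)) (⟦ φ ⟧ (δP sig (conSrc c)) x)
            ≡⟨ cong (∂ φ (gen (con c) ⋆₀ gen (con c))) (⟦δP⟧ (conSrc c) x h) ⟩
          ∂ φ (gen (con c) ⋆₀ gen (con c)) (joinV x x)
            ≡⟨ ∂-⋆₀-joinV (gen (con c)) (gen (con c)) x x ⟩
          ∂ φ (gen (con c)) x ⊔ ∂ φ (gen (con c)) x
            ≤⟨ ⊔-lub con≤M con≤M ⟩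
          M ∎)
      where
      open ≤-Reasoning
      M = ∂ φ (gen (con c) ⋆₁ gen (δ (conTgt c))) x
      con≤M : ∂ φ (gen (con c)) x ≤ M
      con≤M = m≤m⊔n (∂ φ (gen (con c)) x) _

    ε-conservative : ∀ c → ConservativeOn φ (struct (ε-cell c))
    ε-conservative c x h =
      ≤-trans (proj₂ (bounds (εP-nonExpanding (conSrc c)) x h))
              (≤-trans (maxV≤∂-gen (con c) x) (m≤m⊔n (∂ φ (gen (con c)) x) _))

    struct-compatible : ∀ α → CompatibleWith φ (struct α)
    struct-compatible (τ-left c ζ)   = τ-left-compatible c ζ
    struct-compatible (τ-right c ζ)  = τ-right-compatible c ζ
    struct-compatible (δ-cell c)     = δ-compatible c
    struct-compatible (ε-cell _) _ _ = tt

    struct-conservative : ∀ α → ConservativeOn φ (struct α)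
    struct-conservative (τ-left c ζ)  = τ-left-conservative c ζ
    struct-conservative (τ-right c ζ) = τ-right-conservative c ζ
    struct-conservative (δ-cell c)    = δ-conservative c
    struct-conservative (ε-cell c)    = ε-conservative c

proposition3p11 : (Π : Program) (φ : Interpretation Π) → Cartesian φ →
    (α : Cell3 Π) → IsStructure3 φ α → CompatibleWith φ α × ConservativeOn φ α
proposition3p11 Π φ cartesian .(struct α) (α , refl) =
  struct-compatible φ cartesian α , struct-conservative φ cartesian α
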